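{- Let $G$ and $H$ be connected graphs such that $H_{SR}$ is bipartite and has a perfect matching. Let $G_1,\dots,G_k$ be the connected components of $G_{SR}$. If for each $i\in\{1,\dots,k\}$ the graph $G_i$ is Hamiltonian or has a perfect matching, then $$\dim_s(G\Box H)=\frac{|\partial(G)|\,|\partial(H)|}{2}.$$
   Context: All graphs are finite and simple. For a connected graph $G$, $d_G$ is the shortest-path distance and $I_G[u,v]$ is the set of vertices on some shortest $u$–$v$ path. A vertex $w$ strongly resolves $u,v$ if $v\in I_G[u,w]$ or $u\in I_G[v,w]$. A strong resolving set is a set $S\subseteq V(G)$ such that every pair of vertices is strongly resolved by some vertex of $S$; $\dim_s(G)$ is the minimum size of one. A vertex $u$ is maximally distant from $v$ if $d_G(v,w)\le d_G(u,v)$ for every neighbor $w$ of $u$; $u,v$ are mutually maximally distant if each is maximally distant from the other. The boundary $\partial(G)$ is the set of vertices $u$ for which some $v$ exists with $u,v$ mutually maximally distant. The strong resolving graph $G_{SR}$ has vertex set $\partial(G)$, two vertices adjacent iff mutually maximally distant in $G$. $G\Box H$ is the Cartesian product: vertex set $V(G)\times V(H)$, $(a,b)\sim(c,d)$ iff ($a=c$ and $bd\in E(H)$) or ($b=d$ and $ac\in E(G)$). -}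

module Defs where

open import Level using (0ℓ)
open import Data.Nat using (ℕ; zero; suc; _+_; _≤_)
open import Data.Fin using (Fin; inject₁; fromℕ) renaming (zero to fzero; suc to fsuc)
import Data.Fin as F
import Data.Fin.Properties as FP
open import Data.Product using (Σ; Σ-syntax; ∃; ∃-syntax; _×_; _,_; proj₁; proj₂)
open import Data.Product.Function.NonDependent.Propositional using (_×-↔_)
open import Data.Sum using (_⊎_; inj₁; inj₂)
open import Data.Empty using (⊥)
open import Data.Bool using (Bool)
open import Relation.Nullary using (¬_; Dec; yes; no)
open import Relation.Nullary.Decidable using (_×-dec_; _⊎-dec_)
open import Relation.Binary.PropositionalEquality using (_≡_; _≢_; refl; cong; sym; trans)
open import Function.Bundles using (_↔_; Inverse; _⇔_)
open import Function.Definitions using (Injective)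
open import Function.Construct.Composition using (_↔-∘_)

record Graph : Set₁ where
  field
    V       : Set
    size    : ℕ
    enum    : Fin size ↔ V
    E       : V → V → Set
    E-dec   : ∀ u v → Dec (E u v)
    E-sym   : ∀ {u v} → E u v → E v u
    E-irr   : ∀ u → ¬ E u u

  _≟V_ : (u v : V) → Dec (u ≡ v)
  u ≟V v with Inverse.from enum u F.≟ Inverse.from enum v
  ... | yes p = yes (trans (sym (Inverse.strictlyInverseˡ enum u))
                     (trans (cong (Inverse.to enum) p) (Inverse.strictlyInverseˡ enum v)))
  ... | no ¬p = no (λ e → ¬p (cong (Inverse.from enum) e))

open Graph public

data Walk (G : Graph) : V G → V G → ℕ → Set where
  here : ∀ {u} → Walk G u u 0
  step : ∀ {u w v k} → E G u w → Walk G w v k → Walk G u v (suc k)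

Connected : Graph → Set
Connected G = ∀ (u v : V G) → ∃[ k ] Walk G u v k

Dist : (G : Graph) → V G → V G → ℕ → Set
Dist G u v d = Walk G u v d × (∀ k → Walk G u v k → d ≤ k)

InInterval : (G : Graph) → V G → V G → V G → Set
InInterval G u v x = Σ[ a ∈ ℕ ] Σ[ b ∈ ℕ ] (Dist G u x a × Dist G x v b × Dist G u v (a + b))

StronglyResolves : (G : Graph) → V G → V G → V G → Set
StronglyResolves G w u v = InInterval G u w v ⊎ InInterval G v w u

HasSize : {A : Set} → (A → Set) → ℕ → Set
HasSize {A} P n = Σ[ f ∈ (Fin n → A) ] (Injective _≡_ _≡_ f × (∀ x → P x ⇔ (∃[ i ] f i ≡ x)))

StrongResolvingSet : (G : Graph) → (V G → Set) → Set
StrongResolvingSet G S = ∀ (u v : V G) → u ≢ v → ∃[ w ] (S w × StronglyResolves G w u v)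

IsStrongMetricDim : Graph → ℕ → Set₁
IsStrongMetricDim G d =
  (Σ[ S ∈ (V G → Set) ] (HasSize S d × StrongResolvingSet G S)) ×
  (∀ (S : V G → Set) s → HasSize S s → StrongResolvingSet G S → d ≤ s)

MaxDistFrom : (G : Graph) → V G → V G → Set
MaxDistFrom G u v = ∀ w → E G u w → ∀ a b → Dist G v w a → Dist G u v b → a ≤ b

MutMaxDist : (G : Graph) → V G → V G → Set
MutMaxDist G u v = MaxDistFrom G u v × MaxDistFrom G v u

Boundary : (G : Graph) → V G → Set
Boundary G u = ∃[ v ] MutMaxDist G u v

-- G_SR: vertex set  Boundary G,  adjacency  SRAdj G  (a simple graph: no loops)
SRAdj : (G : Graph) → V G → V G → Set
SRAdj G u v = u ≢ v × MutMaxDist G u v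

-- Graph notions for a graph given by a vertex predicate P and adjacency R
-- (used for G_SR, its components, and H_SR)

Bipartite : {A : Set} → (A → Set) → (A → A → Set) → Set
Bipartite {A} P R = Σ[ c ∈ (A → Bool) ] (∀ u v → P u → P v → R u v → c u ≢ c v)

PerfectMatching : {A : Set} → (A → Set) → (A → A → Set) → Set₁
PerfectMatching {A} P R =
  Σ[ M ∈ (A → A → Set) ]
    ((∀ u v → M u v → P u × P v × R u v) ×
     (∀ u v → M u v → M v u) ×
     (∀ u → P u → ∃[ v ] (M u v × (∀ w → M u w → w ≡ v))))

-- Hamiltonian: a cycle c₀ c₁ … c_k c₀ (k+1 ≥ 3) through all vertices, each exactly once
Hamiltonian : {A : Set} → (A → Set) → (A → A → Set) → Set
Hamiltonian {A} P R =
  Σ[ k ∈ ℕ ] Σ[ c ∈ (Fin (suc k) → A) ]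
    (2 ≤ k ×
     Injective _≡_ _≡_ c ×
     (∀ x → P x ⇔ (∃[ i ] c i ≡ x)) ×
     (∀ (i : Fin k) → R (c (inject₁ i)) (c (fsuc i))) ×
     R (c (fromℕ k)) (c fzero))

data SRReach (G : Graph) : V G → V G → Set where
  refl′ : ∀ {u} → SRReach G u u
  step′ : ∀ {u w v} → SRAdj G u w → SRReach G w v → SRReach G u v

SRComponent : (G : Graph) → V G → V G → Set
SRComponent G x u = SRReach G x u

_□_ : Graph → Graph → Graph
G □ H = record
  { V     = V G × V H
  ; size  = size G Data.Nat.* size H
  ; enum  = (enum G ×-↔ enum H) ↔-∘ FP.*↔×
  ; E     = λ { (a , b) (c , d) → (a ≡ c × E H b d) ⊎ (b ≡ d × E G a c) }
  ; E-dec = λ { (a , b) (c , d) → ((_≟V_ G a c) ×-dec E-dec H b d) ⊎-dec ((_≟V_ H b d) ×-dec E-dec G a c) }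
  ; E-sym = λ { (inj₁ (refl , e)) → inj₁ (refl , E-sym H e) ; (inj₂ (refl , e)) → inj₂ (refl , E-sym G e) }
  ; E-irr = λ { (a , b) (inj₁ (_ , e)) → E-irr H b e ; (a , b) (inj₂ (_ , e)) → E-irr G a e }
  }

module Submission where

-- Strong resolving sets of a connected graph are exactly the sets meeting every mutually
-- maximally distant pair: each pair u ≠ v is strongly resolved by both ends of such a pair
-- (extend a geodesic through v, then one back through u), and only the two ends of such a pair
-- strongly resolve it. Distances in G □ H add up, so (g,h),(g′,h′) are mutually maximally distant
-- iff g,g′ and h,h′ are. Thus ∂G × T, for a colour class T of H_SR, is a strong resolving set; the
-- perfect matching of H_SR swaps the two classes, so |T| = |∂H|/2. Conversely the Hamiltonian
-- cycles and perfect matchings of the components of G_SR give an injection τ on ∂G with each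
-- g, τ g mutually maximally distant; with the matching σ of H_SR, the pairs (g,h),(τ g,σ h) for
-- g ∈ ∂G, h ∈ T are disjoint, and every strong resolving set must meet each of them.

open import Defs
open import Data.Nat using (ℕ; _*_; _/_)
open import Data.Sum using (_⊎_)

open import Data.Bool using (Bool; true; false)
import Data.Bool as Bool
open import Data.Fin using (Fin; toℕ; inject₁) renaming (zero to fzero; suc to fsuc)
open import Data.Fin.Properties using (any?; all?; toℕ-injective; suc-injective; injective⇒≤; *↔×)
open import Data.Fin.Relation.Unary.Top using (view; ‵fromℕ; ‵inj₁) renaming (View to TopView)
open import Data.List using (List; []; _∷_; filter; allFin)
import Data.List as List
open import Data.List.Extrema.Nat using (argmax; argmax-all; f[xs]≤f[argmax])
open import Data.List.Membership.Propositional using (_∈_)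
open import Data.List.Membership.Propositional.Properties using (∈-allFin; ∈-map⁺; ∈-filter⁺)
open import Data.List.Relation.Unary.All using (lookup)
open import Data.List.Relation.Unary.All.Properties using (all-filter)
open import Data.List.Relation.Unary.Any using (here; there)
open import Data.Nat using (zero; suc; _+_; _≤_; _<_; _≤?_; _≟_)
open import Data.Nat.DivMod using (m*n/n≡m)
open import Data.Nat.Properties
  using (≤-trans; ≤-antisym; ≤-reflexive; ≮⇒≥; ≰⇒>; <⇒≱; n<1+n; m<1+n⇒m<n∨m≡n; n≤0⇒n≡0;
         +-comm; +-assoc; +-suc; +-identityʳ; +-mono-≤; +-monoʳ-≤; +-cancelˡ-≤; +-cancelʳ-≤;
         ≤-pred; module ≤-Reasoning)
open import Data.Nat.Solver using (module +-*-Solver)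
open import Data.Product using (Σ-syntax; ∃; ∃-syntax; _×_; _,_; proj₁; proj₂)
open import Data.Sum using (inj₁; inj₂; [_,_]′)
import Data.Sum as Sum
open import Function using (_∘_; id)
open import Function.Bundles using (_↔_; Inverse; _⇔_; mk⇔; Equivalence)
open import Function.Definitions using (Injective)
open import Level using (0ℓ)
open import Relation.Binary using (Rel; IsEquivalence)
open import Relation.Binary.Construct.Closure.ReflexiveTransitive using (Star; ε; _◅_; _◅◅_; reverse)
open import Relation.Binary.PropositionalEquality
open import Relation.Nullary using (¬_; Dec; yes; no; contradiction; ¬?)
open import Relation.Nullary.Decidable using (map′; _×-dec_; _⊎-dec_; _→-dec_; recompute)
open import Relation.Unary using (Pred)

Least : (ℕ → Set) → ℕ → Set
Least P k = P k × (∀ j → P j → k ≤ j)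

module _ {P : ℕ → Set} (P? : ∀ k → Dec (P k)) where
  private
    least-or-none : ∀ n → (∀ j → j < n → ¬ P j) ⊎ ∃ (Least P)
    least-or-none zero = inj₁ (λ _ ())
    least-or-none (suc n) with least-or-none n | P? n
    ... | inj₂ found | _      = inj₂ found
    ... | inj₁ none  | yes pn = inj₂ (n , pn , λ j pj → ≮⇒≥ (λ j<n → none j j<n pj))
    ... | inj₁ none  | no ¬pn = inj₁ λ j j<1+n →
          [ none j , (λ { refl → ¬pn }) ]′ (m<1+n⇒m<n∨m≡n j<1+n)

  minimal : ∀ {n} → P n → ∃ (Least P)
  minimal {n} pn = [ (λ none → contradiction pn (none n (n<1+n n))) , id ]′ (least-or-none (suc n))

least-index : ∀ {n} {P : Pred (Fin n) 0ℓ} → (∀ i → Dec (P i)) → ∃ P →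
              Σ[ i ∈ Fin n ] (P i × (∀ j → P j → toℕ i ≤ toℕ j))
least-index P? (i , pi) with minimal (λ k → any? (λ j → (toℕ j ≟ k) ×-dec P? j)) (i , refl , pi)
... | _ , (i , refl , pi) , least = i , pi , λ j pj → least (toℕ j) (j , refl , pj)

module FiniteType {A : Set} {n : ℕ} (enum : Fin n ↔ A) where
  open Inverse enum using () renaming (to to element; from to index; strictlyInverseˡ to element-index)

  any?ᴬ : {P : Pred A 0ℓ} → (∀ x → Dec (P x)) → Dec (∃ P)
  any?ᴬ {P} P? = map′ (λ { (i , p) → element i , p })
                      (λ { (x , p) → index x , subst P (sym (element-index x)) p })
                      (any? (P? ∘ element))

  all?ᴬ : {P : Pred A 0ℓ} → (∀ x → Dec (P x)) → Dec (∀ x → P x)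
  all?ᴬ {P} P? = map′ (λ h x → subst P (element-index x) (h (index x))) (_∘ element)
                      (all? (P? ∘ element))

  elements : List A
  elements = List.map element (allFin n)

  ∈-elements : ∀ x → x ∈ elements
  ∈-elements x = subst (_∈ elements) (element-index x) (∈-map⁺ element (∈-allFin (index x)))

  maximiser : {P : Pred A 0ℓ} → (∀ x → Dec (P x)) → (f : A → ℕ) → ∃ P →
              Σ[ y ∈ A ] (P y × (∀ z → P z → f z ≤ f y))
  maximiser P? f (x , px) =
    y , argmax-all f px (all-filter P? elements) ,
    λ z pz → lookup (f[xs]≤f[argmax] x candidates) (∈-filter⁺ P? (∈-elements z) pz)
    where
    candidates = filter P? elements
    y = argmax f x candidates

  module Representative {_~_ : Rel A 0ℓ} (~-equiv : IsEquivalence _~_) (_~?_ : ∀ x y → Dec (x ~ y)) where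
    open IsEquivalence ~-equiv using () renaming (sym to ~-sym; trans to ~-trans; reflexive to ~-reflexive)

    private
      least : ∀ x → Σ[ i ∈ Fin n ] (x ~ element i × (∀ j → x ~ element j → toℕ i ≤ toℕ j))
      least x = least-index (λ i → x ~? element i) (index x , ~-reflexive (sym (element-index x)))

    representative : A → A
    representative x = element (proj₁ (least x))

    ~-representative : ∀ x → x ~ representative x
    ~-representative x = proj₁ (proj₂ (least x))

    representative-cong : ∀ {x y} → x ~ y → representative x ≡ representative y
    representative-cong {x} {y} x~y = cong element (toℕ-injective (≤-antisym
      (proj₂ (proj₂ (least x)) _ (~-trans x~y (~-representative y)))
      (proj₂ (proj₂ (least y)) _ (~-trans (~-sym x~y) (~-representative x)))))

-- Cardinality

module _ {A : Set} where
  open Equivalence using (to; from)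

  HasSize-≤ : {B : Set} {P : Pred A 0ℓ} {Q : Pred B 0ℓ} {m n : ℕ} → HasSize P m → HasSize Q n →
              (f : ∀ x → P x → B) → (∀ x p → Q (f x p)) → (∀ x p y q → f x p ≡ f y q → x ≡ y) → m ≤ n
  HasSize-≤ {P = P} (e , e-inj , e-enum) (e′ , _ , e′-enum) f f-∈ f-inj = injective⇒≤ g-inj
    where
    e-∈ : ∀ i → P (e i)
    e-∈ i = from (e-enum (e i)) (i , refl)
    g : _ → _
    g i = proj₁ (to (e′-enum _) (f-∈ (e i) (e-∈ i)))
    g-inj : Injective _≡_ _≡_ g
    g-inj {i} {j} gi≡gj = e-inj (f-inj _ (e-∈ i) _ (e-∈ j) (begin
      f (e i) (e-∈ i) ≡⟨ proj₂ (to (e′-enum _) (f-∈ (e i) (e-∈ i))) ⟨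
      e′ (g i)        ≡⟨ cong e′ gi≡gj ⟩
      e′ (g j)        ≡⟨ proj₂ (to (e′-enum _) (f-∈ (e j) (e-∈ j))) ⟩
      f (e j) (e-∈ j) ∎))
      where open ≡-Reasoning

  HasSize-× : {B : Set} {P : Pred A 0ℓ} {Q : Pred B 0ℓ} {m n : ℕ} → HasSize P m → HasSize Q n →
              HasSize (λ (x : A × B) → P (proj₁ x) × Q (proj₂ x)) (m * n)
  HasSize-× {m = m} {n} (e , e-inj , e-enum) (e′ , e′-inj , e′-enum) = f , f-inj , f-enum
    where
    open Inverse (*↔× {m} {n}) renaming (to to split; from to join)
    f : Fin (m * n) → _
    f k = e (proj₁ (split k)) , e′ (proj₂ (split k))
    f-inj : Injective _≡_ _≡_ f
    f-inj {k} {l} fk≡fl = begin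
      k                 ≡⟨ strictlyInverseʳ k ⟨
      join (split k)    ≡⟨ cong join (cong₂ _,_ (e-inj (cong proj₁ fk≡fl)) (e′-inj (cong proj₂ fk≡fl))) ⟩
      join (split l)    ≡⟨ strictlyInverseʳ l ⟩
      l                 ∎
      where open ≡-Reasoning
    f-enum : ∀ x → _ ⇔ (∃[ k ] f k ≡ x)
    f-enum (a , b) = mk⇔ enumerated member
      where
      enumerated : _ → ∃[ k ] f k ≡ (a , b)
      enumerated (p , q) with to (e-enum a) p | to (e′-enum b) q
      ... | i , refl | j , refl = join (i , j) , cong (λ ij → e (proj₁ ij) , e′ (proj₂ ij)) (strictlyInverseˡ (i , j))
      member : ∃[ k ] f k ≡ (a , b) → _
      member (k , refl) = from (e-enum a) (_ , refl) , from (e′-enum b) (_ , refl)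

  HasSize-restrict : {P Q : Pred A 0ℓ} {m n : ℕ} → (P-size : HasSize P n) →
              HasSize (Q ∘ proj₁ P-size) m → HasSize (λ x → P x × Q x) m
  HasSize-restrict {P} {Q} (e , e-inj , e-enum) (g , g-inj , g-enum) = e ∘ g , g-inj ∘ e-inj , λ x → mk⇔ (enumerated x) member
    where
    enumerated : ∀ x → P x × Q x → ∃[ j ] e (g j) ≡ x
    enumerated x (p , q) with to (e-enum x) p
    ... | i , refl with to (g-enum i) q
    ...   | j , refl = j , refl
    member : ∀ {x} → ∃[ j ] e (g j) ≡ x → P x × Q x
    member (j , refl) = from (e-enum _) (g j , refl) , from (g-enum (g j)) (j , refl)

module _ {n : ℕ} {Q : Pred (Fin (suc n)) 0ℓ} where
  open Equivalence using (to; from)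

  HasSize-fzero-∈ : ∀ {m} → Q fzero → HasSize (Q ∘ fsuc) m → HasSize Q (suc m)
  HasSize-fzero-∈ q₀ (g , g-inj , g-enum) = g′ , g′-inj , g′-enum
    where
    g′ : Fin (suc _) → Fin (suc n)
    g′ fzero    = fzero
    g′ (fsuc j) = fsuc (g j)
    g′-inj : Injective _≡_ _≡_ g′
    g′-inj {fzero}  {fzero}  _  = refl
    g′-inj {fsuc i} {fsuc j} eq = cong fsuc (g-inj (suc-injective eq))
    g′-inj {fzero}  {fsuc _} ()
    g′-inj {fsuc _} {fzero}  ()
    g′-enum : ∀ i → Q i ⇔ (∃[ j ] g′ j ≡ i)
    g′-enum fzero    = mk⇔ (λ _ → fzero , refl) (λ _ → q₀)
    g′-enum (fsuc i) = mk⇔ (λ q → let j , gj≡i = to (g-enum i) q in fsuc j , cong fsuc gj≡i)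
                           (λ { (fzero , ()) ; (fsuc j , eq) → from (g-enum i) (j , suc-injective eq) })

  HasSize-fzero-∉ : ∀ {m} → ¬ Q fzero → HasSize (Q ∘ fsuc) m → HasSize Q m
  HasSize-fzero-∉ ¬q₀ (g , g-inj , g-enum) = fsuc ∘ g , g-inj ∘ suc-injective , g′-enum
    where
    g′-enum : ∀ i → Q i ⇔ (∃[ j ] fsuc (g j) ≡ i)
    g′-enum fzero    = mk⇔ (λ q₀ → contradiction q₀ ¬q₀) (λ ())
    g′-enum (fsuc i) = mk⇔ (λ q → let j , gj≡i = to (g-enum i) q in j , cong fsuc gj≡i)
                           (λ { (j , eq) → from (g-enum i) (j , suc-injective eq) })

Fin-partition : ∀ n {Q : Pred (Fin n) 0ℓ} → (∀ i → Dec (Q i)) →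
                Σ[ m ∈ ℕ ] Σ[ m′ ∈ ℕ ] (HasSize Q m × HasSize (¬_ ∘ Q) m′ × m + m′ ≡ n)
Fin-partition zero    Q? = 0 , 0 , empty , empty , refl
  where
  empty : ∀ {R : Pred (Fin 0) 0ℓ} → HasSize R 0
  empty = (λ ()) , (λ {i} → λ { }) , λ ()
Fin-partition (suc n) Q? with Fin-partition n (Q? ∘ fsuc) | Q? fzero
... | m , m′ , Q-size , ¬Q-size , m+m′≡n | yes q₀ =
  suc m , m′ , HasSize-fzero-∈ q₀ Q-size , HasSize-fzero-∉ (λ ¬q₀ → ¬q₀ q₀) ¬Q-size , cong suc m+m′≡n
... | m , m′ , Q-size , ¬Q-size , m+m′≡n | no ¬q₀ =
  m , suc m′ , HasSize-fzero-∉ ¬q₀ Q-size , HasSize-fzero-∈ ¬q₀ ¬Q-size , trans (+-suc m m′) (cong suc m+m′≡n)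

HasSize-partition : {A : Set} {P Q : Pred A 0ℓ} {n : ℕ} → HasSize P n → (∀ x → Dec (Q x)) →
                    Σ[ m ∈ ℕ ] Σ[ m′ ∈ ℕ ]
                      (HasSize (λ x → P x × Q x) m × HasSize (λ x → P x × ¬ Q x) m′ × m + m′ ≡ n)
HasSize-partition P-size Q? with Fin-partition _ (Q? ∘ proj₁ P-size)
... | m , m′ , Q-size , ¬Q-size , m+m′≡n = m , m′ , HasSize-restrict P-size Q-size , HasSize-restrict P-size ¬Q-size , m+m′≡n

-- The pairs {x, σ x} with x ∈ M are pairwise disjoint, and S meets each of them.
matching≤cover : {A : Set} {M S : Pred A 0ℓ} {m s : ℕ} → HasSize M m → HasSize S s →
                 (σ : ∀ x → M x → A) → (∀ x p → ¬ M (σ x p)) → (∀ x p y q → σ x p ≡ σ y q → x ≡ y) →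
                 (∀ x p → S x ⊎ S (σ x p)) → m ≤ s
matching≤cover {M = M} {S} M-size S-size σ σ∉M σ-injective cover =
  HasSize-≤ M-size S-size chosen chosen-∈ chosen-injective
  where
  chosen : ∀ x p → _
  chosen x p = [ (λ _ → x) , (λ _ → σ x p) ]′ (cover x p)
  chosen-∈ : ∀ x p → S (chosen x p)
  chosen-∈ x p with cover x p
  ... | inj₁ Sx  = Sx
  ... | inj₂ Sσx = Sσx
  chosen-injective : ∀ x p y q → chosen x p ≡ chosen y q → x ≡ y
  chosen-injective x p y q eq with cover x p | cover y q
  ... | inj₁ _ | inj₁ _ = eq
  ... | inj₂ _ | inj₂ _ = σ-injective x p y q eq
  ... | inj₁ _ | inj₂ _ = contradiction (subst M eq p) (σ∉M y q)
  ... | inj₂ _ | inj₁ _ = contradiction (subst M (sym eq) q) (σ∉M x p)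

module StarDecidable {A : Set} (_≟_ : ∀ (x y : A) → Dec (x ≡ y)) {R : Rel A 0ℓ} (R? : ∀ x y → Dec (R x y)) where

  -- Warshall's algorithm: Via vs x y says that y is reachable from x through intermediate
  -- vertices taken from vs only.
  Via : List A → Rel A 0ℓ
  Via []       x y = x ≡ y ⊎ R x y
  Via (v ∷ vs) x y = Via vs x y ⊎ (Via vs x v × Via vs v y)

  Via? : ∀ vs x y → Dec (Via vs x y)
  Via? []       x y = (x ≟ y) ⊎-dec R? x y
  Via? (v ∷ vs) x y = Via? vs x y ⊎-dec (Via? vs x v ×-dec Via? vs v y)

  Via⇒Star : ∀ vs {x y} → Via vs x y → Star R x y
  Via⇒Star []       (inj₁ refl)     = ε
  Via⇒Star []       (inj₂ r)        = r ◅ ε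
  Via⇒Star (v ∷ vs) (inj₁ p)        = Via⇒Star vs p
  Via⇒Star (v ∷ vs) (inj₂ (p , q))  = Via⇒Star vs p ◅◅ Via⇒Star vs q

  Via-refl : ∀ vs x → Via vs x x
  Via-refl []       x = inj₁ refl
  Via-refl (v ∷ vs) x = inj₁ (Via-refl vs x)

  Via-edge : ∀ vs {x y} → R x y → Via vs x y
  Via-edge []       r = inj₂ r
  Via-edge (v ∷ vs) r = inj₁ (Via-edge vs r)

  Via-◅ : ∀ vs {x y z} → R x y → y ∈ vs → Via vs y z → Via vs x z
  Via-◅ (v ∷ vs) r (here refl) (inj₁ p)       = inj₂ (Via-edge vs r , p)
  Via-◅ (v ∷ vs) r (here refl) (inj₂ (_ , q)) = inj₂ (Via-edge vs r , q)
  Via-◅ (v ∷ vs) r (there y∈vs) (inj₁ p)       = inj₁ (Via-◅ vs r y∈vs p)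
  Via-◅ (v ∷ vs) r (there y∈vs) (inj₂ (p , q)) = inj₂ (Via-◅ vs r y∈vs p , q)

  module _ (vs : List A) (∈-vs : ∀ x → x ∈ vs) where
    Star⇒Via : ∀ {x y} → Star R x y → Via vs x y
    Star⇒Via ε       = Via-refl vs _
    Star⇒Via (r ◅ p) = Via-◅ vs r (∈-vs _) (Star⇒Via p)

    Star? : ∀ x y → Dec (Star R x y)
    Star? x y = map′ (Via⇒Star vs) Star⇒Via (Via? vs x y)

-- Injective neighbour maps

record InjectiveNeighbourMap {A : Set} (P : Pred A 0ℓ) (R : Rel A 0ℓ) : Set where
  field
    τ           : ∀ x → P x → A
    τ-∈         : ∀ x p → P (τ x p)
    τ-adjacent  : ∀ x p → R x (τ x p)
    τ-injective : ∀ x p y q → τ x p ≡ τ y q → x ≡ y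

module _ {A : Set} {P : Pred A 0ℓ} {R : Rel A 0ℓ} where
  open Equivalence using (to; from)

  perfectMatching⇒InjectiveNeighbourMap : PerfectMatching P R → InjectiveNeighbourMap P R
  perfectMatching⇒InjectiveNeighbourMap (M , M⊆R , M-sym , M-unique) = record
    { τ           = partner
    ; τ-∈         = λ x p → proj₁ (proj₂ (M⊆R x _ (M-partner x p)))
    ; τ-adjacent  = λ x p → proj₂ (proj₂ (M⊆R x _ (M-partner x p)))
    ; τ-injective = injective
    }
    where
    partner : ∀ x → P x → A
    partner x p = proj₁ (M-unique x p)
    M-partner : ∀ x p → M x (partner x p)
    M-partner x p = proj₁ (proj₂ (M-unique x p))
    injective : ∀ x p y q → partner x p ≡ partner y q → x ≡ y
    injective x p y q eq with partner x p | M-partner x p | partner y q | M-partner y q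
    injective x p y q refl | v | Mxv | .v | Myv =
      let _ , Pv , _ = M⊆R x v Mxv
          _ , _ , only = M-unique v Pv
      in trans (only x (M-sym x v Mxv)) (sym (only y (M-sym y v Myv)))

  -- Successor modulo k + 1.
  private
    next : ∀ {k} {i : Fin (suc k)} → TopView i → Fin (suc k)
    next ‵fromℕ            = fzero
    next (‵inj₁ {i = j} _) = fsuc j

    next-injective : ∀ {k} {i i′ : Fin (suc k)} (v : TopView i) (v′ : TopView i′) → next v ≡ next v′ → i ≡ i′
    next-injective ‵fromℕ    ‵fromℕ    _  = refl
    next-injective (‵inj₁ _) (‵inj₁ _) eq = cong inject₁ (suc-injective eq)

  hamiltonian⇒InjectiveNeighbourMap : Hamiltonian P R → InjectiveNeighbourMap P R
  hamiltonian⇒InjectiveNeighbourMap (k , c , _ , c-inj , c-enum , c-path , c-close) = record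
    { τ           = λ x p → c (next (view (index x p)))
    ; τ-∈         = λ x p → from (c-enum _) (_ , refl)
    ; τ-adjacent  = adjacent
    ; τ-injective = injective
    }
    where
    index : ∀ x → P x → Fin (suc k)
    index x p = proj₁ (to (c-enum x) p)
    cycle : ∀ {i} (v : TopView i) → R (c i) (c (next v))
    cycle ‵fromℕ            = c-close
    cycle (‵inj₁ {i = j} _) = c-path j
    adjacent : ∀ x p → R x (c (next (view (index x p))))
    adjacent x p with to (c-enum x) p
    ... | i , refl = cycle (view i)
    injective : ∀ x p y q → c (next (view (index x p))) ≡ c (next (view (index y q))) → x ≡ y
    injective x p y q eq with to (c-enum x) p | to (c-enum y) q
    ... | i , refl | j , refl = cong c (next-injective (view i) (view j) (c-inj eq))

either-true : ∀ {x y : Bool} → x ≢ y → x ≡ true ⊎ y ≡ true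
either-true {true}           _   = inj₁ refl
either-true {false} {true}   _   = inj₂ refl
either-true {false} {false} x≢y = contradiction refl x≢y

module _ {A : Set} {P : Pred A 0ℓ} {R : Rel A 0ℓ} (c : A → Bool) (c-proper : ∀ u v → P u → P v → R u v → c u ≢ c v) where

  colourClass-cover : ∀ x y → P x → P y → R x y → (P x × c x ≡ true) ⊎ (P y × c y ≡ true)
  colourClass-cover x y px py r = Sum.map (px ,_) (py ,_) (either-true (c-proper x y px py r))

  τ-leaves-colourClass : (N : InjectiveNeighbourMap P R) → let open InjectiveNeighbourMap N in
                         ∀ x p → c x ≡ true → c (τ x p) ≢ true
  τ-leaves-colourClass N x p cx≡true cτx≡true =
    c-proper x (τ x p) p (τ-∈ x p) (τ-adjacent x p) (trans cx≡true (sym cτx≡true))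
    where open InjectiveNeighbourMap N

  -- τ swaps the two colour classes injectively, so they have the same size.
  colourClass-half : ∀ {n} → HasSize P n → InjectiveNeighbourMap P R →
                     Σ[ t ∈ ℕ ] (HasSize (λ x → P x × c x ≡ true) t × n ≡ t + t)
  colourClass-half P-size N with HasSize-partition P-size (λ x → c x Bool.≟ true)
  ... | t , f , T-size , F-size , t+f≡n = t , T-size , trans (sym t+f≡n) (cong (t +_) (≤-antisym f≤t t≤f))
    where
    open InjectiveNeighbourMap N
    t≤f : t ≤ f
    t≤f = HasSize-≤ T-size F-size (λ x (p , _) → τ x p)
            (λ x (p , cx≡true) → τ-∈ x p , τ-leaves-colourClass N x p cx≡true)
            (λ x (p , _) y (q , _) → τ-injective x p y q)
    f≤t : f ≤ t
    f≤t = HasSize-≤ F-size T-size (λ x (p , _) → τ x p)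
            (λ x (p , cx≢true) → τ-∈ x p , [ (λ cx≡true → contradiction cx≡true cx≢true) , id ]′
                                                (either-true (c-proper x (τ x p) p (τ-∈ x p) (τ-adjacent x p))))
            (λ x (p , _) y (q , _) → τ-injective x p y q)

-- Walks and distance

module Walks (G : Graph) where
  _++ᵂ_ : ∀ {u v w k l} → Walk G u v k → Walk G v w l → Walk G u w (k + l)
  here     ++ᵂ q = q
  step e p ++ᵂ q = step e (p ++ᵂ q)

  reverseᵂ : ∀ {u v k} → Walk G u v k → Walk G v u k
  reverseᵂ here                  = here
  reverseᵂ {k = suc k} (step e p) = subst (Walk G _ _) (+-comm k 1) (reverseᵂ p ++ᵂ step (E-sym G e) here)

  walk? : ∀ k u v → Dec (Walk G u v k)
  walk? zero    u v = map′ (λ { refl → here }) (λ { here → refl }) (_≟V_ G u v)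
  walk? (suc k) u v = map′ (λ { (w , e , p) → step e p }) (λ { (step e p) → _ , e , p })
                           (any?ᴬ (λ w → E-dec G u w ×-dec walk? k w v))
    where open FiniteType (enum G)

  distance : Connected G → ∀ u v → ∃ (Dist G u v)
  distance conn u v = minimal (λ k → walk? k u v) (proj₂ (conn u v))

module Metric (G : Graph) (d : V G → V G → ℕ) (d-Dist : ∀ u v → Dist G u v (d u v)) where
  open Walks G
  open FiniteType (enum G) using (any?ᴬ; all?ᴬ; maximiser)

  geodesic : ∀ u v → Walk G u v (d u v)
  geodesic u v = proj₁ (d-Dist u v)

  d-minimal : ∀ {u v k} → Walk G u v k → d u v ≤ k
  d-minimal {u} {v} = proj₂ (d-Dist u v) _

  Dist⇒≡ : ∀ {u v a} → Dist G u v a → a ≡ d u v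
  Dist⇒≡ {u} {v} (walk , shortest) = ≤-antisym (shortest _ (geodesic u v)) (d-minimal walk)

  d-refl : ∀ u → d u u ≡ 0
  d-refl u = n≤0⇒n≡0 (d-minimal {u} here)

  d≡0⇒≡ : ∀ {u v} → d u v ≡ 0 → u ≡ v
  d≡0⇒≡ {u} {v} d≡0 with subst (Walk G u v) d≡0 (geodesic u v)
  ... | here = refl

  d-sym : ∀ u v → d u v ≡ d v u
  d-sym u v = ≤-antisym (d-minimal (reverseᵂ (geodesic v u))) (d-minimal (reverseᵂ (geodesic u v)))

  d-triangle : ∀ u v w → d u w ≤ d u v + d v w
  d-triangle u v w = d-minimal (geodesic u v ++ᵂ geodesic v w)

  d-stepˡ : ∀ {u z w} → E G u z → d u w ≤ suc (d z w)
  d-stepˡ {z = z} {w} e = d-minimal (step e (geodesic z w))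

  d-stepʳ : ∀ {u w z} → E G w z → d u z ≤ suc (d u w)
  d-stepʳ {u} {w} e = ≤-trans (d-minimal (geodesic u w ++ᵂ step e here)) (≤-reflexive (+-comm (d u w) 1))

  first-step : ∀ {u w k} → d u w ≡ suc k → Σ[ z ∈ V G ] (E G u z × d z w ≡ k)
  first-step {u} {w} {k} d≡1+k with subst (Walk G u w) d≡1+k (geodesic u w)
  ... | step {w = z} e p = z , e , ≤-antisym (d-minimal p) (≤-pred (subst (_≤ suc (d z w)) d≡1+k (d-stepˡ e)))

  MaxDistFrom⇒≤ : ∀ {u v} → MaxDistFrom G u v → ∀ w → E G u w → d v w ≤ d u v
  MaxDistFrom⇒≤ {u} {v} m w e = m w e _ _ (d-Dist v w) (d-Dist u v)

  ≤⇒MaxDistFrom : ∀ {u v} → (∀ w → E G u w → d v w ≤ d u v) → MaxDistFrom G u v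
  ≤⇒MaxDistFrom ≤d w e _ _ Da Db = subst₂ _≤_ (sym (Dist⇒≡ Da)) (sym (Dist⇒≡ Db)) (≤d w e)

  InInterval⇒≡ : ∀ {u v x} → InInterval G u v x → d u x + d x v ≡ d u v
  InInterval⇒≡ (_ , _ , Da , Db , Dab) = trans (cong₂ _+_ (sym (Dist⇒≡ Da)) (sym (Dist⇒≡ Db))) (Dist⇒≡ Dab)

  ≡⇒InInterval : ∀ {u v x} → d u x + d x v ≡ d u v → InInterval G u v x
  ≡⇒InInterval {u} {v} {x} eq = _ , _ , d-Dist u x , d-Dist x v , subst (Dist G u v) (sym eq) (d-Dist u v)

  MaxDistFrom? : ∀ u v → Dec (MaxDistFrom G u v)
  MaxDistFrom? u v = map′ ≤⇒MaxDistFrom MaxDistFrom⇒≤ (all?ᴬ (λ w → E-dec G u w →-dec (d v w ≤? d u v)))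

  MutMaxDist? : ∀ u v → Dec (MutMaxDist G u v)
  MutMaxDist? u v = MaxDistFrom? u v ×-dec MaxDistFrom? v u

  Boundary? : ∀ u → Dec (Boundary G u)
  Boundary? u = any?ᴬ (MutMaxDist? u)

  SRAdj? : ∀ u v → Dec (SRAdj G u v)
  SRAdj? u v = ¬? (_≟V_ G u v) ×-dec MutMaxDist? u v

  MaxDistFrom-self⇒≡ : ∀ {u} → MaxDistFrom G u u → ∀ v → u ≡ v
  MaxDistFrom-self⇒≡ {u} m v with d u v in d≡
  ... | zero  = d≡0⇒≡ d≡
  ... | suc k with first-step d≡
  ...   | z , e , _ = contradiction (subst (E G u) (sym u≡z) e) (E-irr G u)
    where
    u≡z : u ≡ z
    u≡z = d≡0⇒≡ (n≤0⇒n≡0 (subst (d u z ≤_) (d-refl u) (MaxDistFrom⇒≤ m z e)))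

  MaxDistFrom-interval⇒≡ : ∀ {x y w} → MaxDistFrom G y x → InInterval G x w y → w ≡ y
  MaxDistFrom-interval⇒≡ {x} {y} {w} m y∈I with d y w in d≡
  ... | zero  = sym (d≡0⇒≡ d≡)
  ... | suc k with first-step d≡
  ...   | z , e , dzw≡k = contradiction (MaxDistFrom⇒≤ m z e) (<⇒≱ (subst (_< d x z) (d-sym x y) farther))
    where
    open ≤-Reasoning
    farther : d x y < d x z
    farther = +-cancelʳ-≤ k (suc (d x y)) (d x z) (begin
      suc (d x y) + k ≡⟨ +-suc (d x y) k ⟨
      d x y + suc k   ≡⟨ cong (d x y +_) d≡ ⟨
      d x y + d y w   ≡⟨ InInterval⇒≡ y∈I ⟩
      d x w           ≤⟨ d-triangle x z w ⟩
      d x z + d z w   ≡⟨ cong (d x z +_) dzw≡k ⟩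
      d x z + k       ∎)

  strongResolver-MutMaxDist : ∀ {x y w} → MutMaxDist G x y → StronglyResolves G w x y → w ≡ x ⊎ w ≡ y
  strongResolver-MutMaxDist (_ , y-max) (inj₁ y∈I) = inj₂ (MaxDistFrom-interval⇒≡ y-max y∈I)
  strongResolver-MutMaxDist (x-max , _) (inj₂ x∈I) = inj₁ (MaxDistFrom-interval⇒≡ x-max x∈I)

  -- y is a vertex farthest from u among those with v on a shortest u–y path.
  maxDistant-extension : ∀ u v → Σ[ y ∈ V G ] (d u v + d v y ≡ d u y × MaxDistFrom G y u)
  maxDistant-extension u v
    with maximiser (λ y → d u v + d v y ≟ d u y) (d u) (v , trans (cong (d u v +_) (d-refl v)) (+-identityʳ _))
  ... | y , v-on-uy , farthest = y , v-on-uy , ≤⇒MaxDistFrom (λ z e → subst (d u z ≤_) (d-sym u y) (not-farther z e))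
    where
    not-farther : ∀ z → E G y z → d u z ≤ d u y
    not-farther z e with d u z ≤? d u y
    ... | yes ≤d = ≤d
    ... | no  ≰d = contradiction (farthest z v-on-uz) (<⇒≱ (≰⇒> ≰d))
      where
      open ≤-Reasoning
      v-on-uz : d u v + d v z ≡ d u z
      v-on-uz = ≤-antisym (begin
        d u v + d v z       ≤⟨ +-monoʳ-≤ (d u v) (d-stepʳ e) ⟩
        d u v + suc (d v y) ≡⟨ +-suc (d u v) (d v y) ⟩
        suc (d u v + d v y) ≡⟨ cong suc v-on-uy ⟩
        suc (d u y)         ≤⟨ ≰⇒> ≰d ⟩
        d u z               ∎) (d-triangle u v z)

  MutMaxDist-resolvers : ∀ u v → Σ[ x ∈ V G ] Σ[ y ∈ V G ]
                           (MutMaxDist G x y × StronglyResolves G x u v × StronglyResolves G y u v)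
  MutMaxDist-resolvers u v with maxDistant-extension u v
  ... | y , v-on-uy , y-max with maxDistant-extension y u
  ...   | x , u-on-yx , x-max = x , y , (x-max , y-max′) , inj₂ (≡⇒InInterval u-on-vx) , inj₁ (≡⇒InInterval v-on-uy)
    where
    v-on-yu : d y v + d v u ≡ d y u
    v-on-yu = begin
      d y v + d v u ≡⟨ cong₂ _+_ (d-sym y v) (d-sym v u) ⟩
      d v y + d u v ≡⟨ +-comm (d v y) (d u v) ⟩
      d u v + d v y ≡⟨ v-on-uy ⟩
      d u y         ≡⟨ d-sym u y ⟩
      d y u         ∎
      where open ≡-Reasoning
    y-max′ : MaxDistFrom G y x
    y-max′ = ≤⇒MaxDistFrom λ z e → begin
      d x z         ≤⟨ d-triangle x u z ⟩
      d x u + d u z ≤⟨ +-monoʳ-≤ (d x u) (MaxDistFrom⇒≤ y-max z e) ⟩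
      d x u + d y u ≡⟨ cong (_+ d y u) (d-sym x u) ⟩
      d u x + d y u ≡⟨ +-comm (d u x) (d y u) ⟩
      d y u + d u x ≡⟨ u-on-yx ⟩
      d y x         ∎
      where open ≤-Reasoning
    u-on-vx : d v u + d u x ≡ d v x
    u-on-vx = ≤-antisym (+-cancelˡ-≤ (d y v) _ _ (begin
      d y v + (d v u + d u x) ≡⟨ +-assoc (d y v) (d v u) (d u x) ⟨
      d y v + d v u + d u x   ≡⟨ cong (_+ d u x) v-on-yu ⟩
      d y u + d u x           ≡⟨ u-on-yx ⟩
      d y x                   ≤⟨ d-triangle y v x ⟩
      d y v + d v x           ∎)) (d-triangle v u x)
      where open ≤-Reasoning

  MutMaxDist-cover⇒StrongResolvingSet : {S : Pred (V G) 0ℓ} →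
    (∀ x y → MutMaxDist G x y → S x ⊎ S y) → StrongResolvingSet G S
  MutMaxDist-cover⇒StrongResolvingSet S-cover u v _ =
    let x , y , x⇆y , x-res , y-res = MutMaxDist-resolvers u v
    in  [ (λ Sx → x , Sx , x-res) , (λ Sy → y , Sy , y-res) ]′ (S-cover x y x⇆y)

  StrongResolvingSet⇒SRAdj-cover : {S : Pred (V G) 0ℓ} →
    StrongResolvingSet G S → ∀ x y → SRAdj G x y → S x ⊎ S y
  StrongResolvingSet⇒SRAdj-cover {S} S-res x y (x≢y , x⇆y) with S-res x y x≢y
  ... | w , Sw , w-res = Sum.map (λ w≡x → subst S w≡x Sw) (λ w≡y → subst S w≡y Sw) (strongResolver-MutMaxDist x⇆y w-res)

  StrongResolvingSet-≥ : {P M S : Pred (V G) 0ℓ} {m s : ℕ} (N : InjectiveNeighbourMap P (SRAdj G)) →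
    let open InjectiveNeighbourMap N in
    (M⊆P : ∀ {x} → M x → P x) → (∀ x (p : M x) → ¬ M (τ x (M⊆P p))) →
    HasSize M m → HasSize S s → StrongResolvingSet G S → m ≤ s
  StrongResolvingSet-≥ N M⊆P τ∉M M-size S-size S-res =
    matching≤cover M-size S-size (λ x p → τ x (M⊆P p)) τ∉M (λ x p y q → τ-injective x (M⊆P p) y (M⊆P q))
                   (λ x p → StrongResolvingSet⇒SRAdj-cover S-res x _ (τ-adjacent x (M⊆P p)))
    where open InjectiveNeighbourMap N

dist : (G : Graph) → Connected G → V G → V G → ℕ
dist G conn u v = proj₁ (Walks.distance G conn u v)

dist-Dist : (G : Graph) (conn : Connected G) → ∀ u v → Dist G u v (dist G conn u v)
dist-Dist G conn u v = proj₂ (Walks.distance G conn u v)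

module ConnectedMetric (G : Graph) (conn : Connected G) = Metric G (dist G conn) (dist-Dist G conn)

-- The Cartesian product

module _ {G H : Graph} where
  Walk-□ˡ : ∀ {g g′ k} (h : V H) → Walk G g g′ k → Walk (G □ H) (g , h) (g′ , h) k
  Walk-□ˡ h here       = here
  Walk-□ˡ h (step e p) = step (inj₂ (refl , e)) (Walk-□ˡ h p)

  Walk-□ʳ : ∀ {h h′ k} (g : V G) → Walk H h h′ k → Walk (G □ H) (g , h) (g , h′) k
  Walk-□ʳ g here       = here
  Walk-□ʳ g (step e p) = step (inj₁ (refl , e)) (Walk-□ʳ g p)

  Walk-□⁻ : ∀ {x y k} → Walk (G □ H) x y k → Σ[ k₁ ∈ ℕ ] Σ[ k₂ ∈ ℕ ]
              (k₁ + k₂ ≡ k × Walk G (proj₁ x) (proj₁ y) k₁ × Walk H (proj₂ x) (proj₂ y) k₂)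
  Walk-□⁻ here = 0 , 0 , refl , here , here
  Walk-□⁻ (step (inj₁ (refl , e)) p) with Walk-□⁻ p
  ... | k₁ , k₂ , refl , pG , pH = k₁ , suc k₂ , +-suc k₁ k₂ , pG , step e pH
  Walk-□⁻ (step (inj₂ (refl , e)) p) with Walk-□⁻ p
  ... | k₁ , k₂ , refl , pG , pH = suc k₁ , k₂ , refl , step e pG , pH

  Dist-□ : ∀ {g g′ h h′ a b} → Dist G g g′ a → Dist H h h′ b → Dist (G □ H) (g , h) (g′ , h′) (a + b)
  Dist-□ {g′ = g′} {h = h} (pG , G-min) (pH , H-min) =
    Walks._++ᵂ_ (G □ H) (Walk-□ˡ h pG) (Walk-□ʳ g′ pH) , shortest
    where
    shortest : ∀ k → Walk (G □ H) _ _ k → _ ≤ k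
    shortest k p with Walk-□⁻ p
    ... | k₁ , k₂ , refl , pG′ , pH′ = +-mono-≤ (G-min k₁ pG′) (H-min k₂ pH′)

module Product (G H : Graph) (G-conn : Connected G) (H-conn : Connected H) where
  private
    dG = dist G G-conn
    dH = dist H H-conn
    module MG = ConnectedMetric G G-conn
    module MH = ConnectedMetric H H-conn

  module Metric□ = Metric (G □ H) (λ x y → dG (proj₁ x) (proj₁ y) + dH (proj₂ x) (proj₂ y))
                     (λ x y → Dist-□ (dist-Dist G G-conn _ _) (dist-Dist H H-conn _ _))

  MaxDistFrom-□⁻ˡ : ∀ {g g′ h h′} → MaxDistFrom (G □ H) (g , h) (g′ , h′) → MaxDistFrom G g g′
  MaxDistFrom-□⁻ˡ {g} {g′} {h} {h′} m = MG.≤⇒MaxDistFrom λ w e → +-cancelʳ-≤ (dH h h′) _ _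
    (subst (λ t → dG g′ w + t ≤ dG g g′ + dH h h′) (MH.d-sym h′ h) (Metric□.MaxDistFrom⇒≤ m (w , h) (inj₂ (refl , e))))

  MaxDistFrom-□⁻ʳ : ∀ {g g′ h h′} → MaxDistFrom (G □ H) (g , h) (g′ , h′) → MaxDistFrom H h h′
  MaxDistFrom-□⁻ʳ {g} {g′} {h} {h′} m = MH.≤⇒MaxDistFrom λ w e → +-cancelˡ-≤ (dG g g′) _ _
    (subst (λ t → t + dH h′ w ≤ dG g g′ + dH h h′) (MG.d-sym g′ g) (Metric□.MaxDistFrom⇒≤ m (g , w) (inj₁ (refl , e))))

  MaxDistFrom-□⁺ : ∀ {g g′ h h′} → MaxDistFrom G g g′ → MaxDistFrom H h h′ → MaxDistFrom (G □ H) (g , h) (g′ , h′)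
  MaxDistFrom-□⁺ {g} {g′} {h} {h′} mG mH = Metric□.≤⇒MaxDistFrom λ
    { (.g , w) (inj₁ (refl , e)) → +-mono-≤ (≤-reflexive (MG.d-sym g′ g)) (MH.MaxDistFrom⇒≤ mH w e)
    ; (w , .h) (inj₂ (refl , e)) → +-mono-≤ (MG.MaxDistFrom⇒≤ mG w e) (≤-reflexive (MH.d-sym h′ h)) }

  MutMaxDist-□⁻ : ∀ {g g′ h h′} → MutMaxDist (G □ H) (g , h) (g′ , h′) → MutMaxDist G g g′ × MutMaxDist H h h′
  MutMaxDist-□⁻ (m , m′) = (MaxDistFrom-□⁻ˡ m , MaxDistFrom-□⁻ˡ m′) , (MaxDistFrom-□⁻ʳ m , MaxDistFrom-□⁻ʳ m′)

  SRAdj-□ : ∀ {g g′ h h′} → SRAdj G g g′ → SRAdj H h h′ → SRAdj (G □ H) (g , h) (g′ , h′)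
  SRAdj-□ (_ , mG , mG′) (h≢h′ , mH , mH′) = h≢h′ ∘ cong proj₂ , MaxDistFrom-□⁺ mG mH , MaxDistFrom-□⁺ mG′ mH′

  InjectiveNeighbourMap-□ : {P : Pred (V G) 0ℓ} {Q : Pred (V H) 0ℓ} →
    InjectiveNeighbourMap P (SRAdj G) → InjectiveNeighbourMap Q (SRAdj H) →
    InjectiveNeighbourMap (λ x → P (proj₁ x) × Q (proj₂ x)) (SRAdj (G □ H))
  InjectiveNeighbourMap-□ NG NH = record
    { τ           = λ (g , h) (p , q) → τ NG g p , τ NH h q
    ; τ-∈         = λ (g , h) (p , q) → τ-∈ NG g p , τ-∈ NH h q
    ; τ-adjacent  = λ (g , h) (p , q) → SRAdj-□ (τ-adjacent NG g p) (τ-adjacent NH h q)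
    ; τ-injective = λ (g , h) (p , q) (g′ , h′) (p′ , q′) eq →
        cong₂ _,_ (τ-injective NG g p g′ p′ (cong proj₁ eq)) (τ-injective NH h q h′ q′ (cong proj₂ eq))
    }
    where open InjectiveNeighbourMap

  Boundary×-covers-MutMaxDist : {T : Pred (V H) 0ℓ} → (∀ h → ¬ MutMaxDist H h h) →
    (∀ h h′ → SRAdj H h h′ → T h ⊎ T h′) →
    let S = λ (x : V G × V H) → Boundary G (proj₁ x) × T (proj₂ x) in
    ∀ x y → MutMaxDist (G □ H) x y → S x ⊎ S y
  Boundary×-covers-MutMaxDist H-nontrivial T-cover (gx , hx) (gy , hy) x⇆y with MutMaxDist-□⁻ x⇆y
  ... | (m , m′) , hx⇆hy =
    Sum.map ((gy , m , m′) ,_) ((gx , m′ , m) ,_) (T-cover hx hy (hx≢hy , hx⇆hy))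
    where
    hx≢hy : hx ≢ hy
    hx≢hy refl = H-nontrivial hx hx⇆hy

-- Components of the strong resolving graph

module _ {G : Graph} where
  SRAdj-sym : ∀ {u v} → SRAdj G u v → SRAdj G v u
  SRAdj-sym (u≢v , m , m′) = u≢v ∘ sym , m′ , m

  SRAdj⇒Boundary : ∀ {u v} → SRAdj G u v → Boundary G u
  SRAdj⇒Boundary (_ , u⇆v) = _ , u⇆v

module _ (G : Graph) (conn : Connected G) where
  open ConnectedMetric G conn using (SRAdj?; Boundary?)
  open InjectiveNeighbourMap

  private
    _~_ : Rel (V G) 0ℓ
    _~_ = Star (SRAdj G)

    ~-isEquivalence : IsEquivalence _~_
    ~-isEquivalence = record { refl = ε ; sym = reverse SRAdj-sym ; trans = _◅◅_ }

    open FiniteType (enum G) using (elements; ∈-elements)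
    open StarDecidable (_≟V_ G) SRAdj? using (Star?)
    open FiniteType.Representative (enum G) ~-isEquivalence (Star? elements ∈-elements)

    Star⇒SRReach : ∀ {u v} → u ~ v → SRReach G u v
    Star⇒SRReach ε       = refl′
    Star⇒SRReach (a ◅ p) = step′ a (Star⇒SRReach p)

    Boundary-~ : ∀ {u v} → u ~ v → Boundary G v → Boundary G u
    Boundary-~ ε                     b = b
    Boundary-~ ((_ , u⇆w) ◅ _) _ = _ , u⇆w

    representative~ : ∀ g → representative g ~ g
    representative~ g = reverse SRAdj-sym (~-representative g)

  glue-components : (N : ∀ r → .(Boundary G r) → InjectiveNeighbourMap (SRComponent G r) (SRAdj G)) →
                    InjectiveNeighbourMap (Boundary G) (SRAdj G)
  glue-components N = record
    { τ           = τ′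
    ; τ-∈         = λ g b → SRAdj⇒Boundary (SRAdj-sym (τ′-adjacent g b))
    ; τ-adjacent  = τ′-adjacent
    ; τ-injective = τ′-injective
    }
    where
    N-at : ∀ g → Boundary G g → InjectiveNeighbourMap (SRComponent G (representative g)) (SRAdj G)
    N-at g b = N (representative g) (Boundary-~ (representative~ g) b)
    τ′ : ∀ g → Boundary G g → V G
    τ′ g b = τ (N-at g b) g (Star⇒SRReach (representative~ g))
    τ′-adjacent : ∀ g b → SRAdj G g (τ′ g b)
    τ′-adjacent g b = τ-adjacent (N-at g b) g _
    same-component : ∀ {r r′ g g′} → r ≡ r′ → .(b : Boundary G r) .(b′ : Boundary G r′) →
      (m : SRReach G r g) (m′ : SRReach G r′ g′) → τ (N r b) g m ≡ τ (N r′ b′) g′ m′ → g ≡ g′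
    same-component {r} refl b _ m m′ = τ-injective (N r b) _ m _ m′
    τ′-injective : ∀ g b g′ b′ → τ′ g b ≡ τ′ g′ b′ → g ≡ g′
    τ′-injective g b g′ b′ eq = same-component (representative-cong g~g′) _ _ _ _ eq
      where
      g~g′ : g ~ g′
      g~g′ = τ′-adjacent g b ◅ subst (_~ g′) (sym eq) (SRAdj-sym (τ′-adjacent g′ b′) ◅ ε)

  -- Boundary proofs are recomputed from a decision procedure, so they are irrelevant and
  -- every vertex of a component uses the same cycle or matching.
  components⇒InjectiveNeighbourMap :
    (∀ x → Boundary G x → Hamiltonian (SRComponent G x) (SRAdj G) ⊎ PerfectMatching (SRComponent G x) (SRAdj G)) →
    InjectiveNeighbourMap (Boundary G) (SRAdj G)
  components⇒InjectiveNeighbourMap structure = glue-components λ r b →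
    [ hamiltonian⇒InjectiveNeighbourMap , perfectMatching⇒InjectiveNeighbourMap ]′ (structure r (recompute (Boundary? r) b))

*-double/2 : ∀ a t → a * (t + t) / 2 ≡ a * t
*-double/2 a t = trans (cong (_/ 2) (solve 2 (λ a t → a :* (t :+ t) := a :* t :* con 2) refl a t)) (m*n/n≡m (a * t) 2)
  where open +-*-Solver

theorem6 : (G H : Graph) → Connected G → Connected H →
           Bipartite (Boundary H) (SRAdj H) → PerfectMatching (Boundary H) (SRAdj H) →
           (∀ x → Boundary G x →
              Hamiltonian (SRComponent G x) (SRAdj G) ⊎ PerfectMatching (SRComponent G x) (SRAdj G)) →
           ∀ (a b : ℕ) → HasSize (Boundary G) a → HasSize (Boundary H) b →
           IsStrongMetricDim (G □ H) ((a * b) / 2)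
theorem6 G H G-conn H-conn (c , c-proper) H-matching G-components a b ∂G-size ∂H-size =
  subst (IsStrongMetricDim (G □ H)) (sym (trans (cong (λ n → a * n / 2) b≡t+t) (*-double/2 a t)))
    ( (S , S-size , Metric□.MutMaxDist-cover⇒StrongResolvingSet S-cover)
    , λ _ _ → Metric□.StrongResolvingSet-≥ (InjectiveNeighbourMap-□ NG NH) S⊆∂×∂ τ∉S S-size )
  where
  open Product G H G-conn H-conn
  open InjectiveNeighbourMap
  NG = components⇒InjectiveNeighbourMap G G-conn G-components
  NH = perfectMatching⇒InjectiveNeighbourMap H-matching
  half = colourClass-half c c-proper ∂H-size NH
  t = proj₁ half
  b≡t+t = proj₂ (proj₂ half)
  S : Pred (V (G □ H)) 0ℓ
  S (g , h) = Boundary G g × Boundary H h × c h ≡ true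
  S-size : HasSize S (a * t)
  S-size = HasSize-× ∂G-size (proj₁ (proj₂ half))
  S-cover : ∀ x y → MutMaxDist (G □ H) x y → S x ⊎ S y
  S-cover = Boundary×-covers-MutMaxDist
    (λ h h⇆h → proj₁ (τ-adjacent NH h (h , h⇆h)) (ConnectedMetric.MaxDistFrom-self⇒≡ H H-conn (proj₁ h⇆h) _))
    (λ h h′ h-h′ → colourClass-cover c c-proper h h′ (SRAdj⇒Boundary h-h′) (SRAdj⇒Boundary (SRAdj-sym h-h′)) h-h′)
  S⊆∂×∂ : ∀ {x} → S x → Boundary G (proj₁ x) × Boundary H (proj₂ x)
  S⊆∂×∂ (bg , bh , _) = bg , bh
  τ∉S : ∀ x (p : S x) → ¬ S (τ (InjectiveNeighbourMap-□ NG NH) x (S⊆∂×∂ p))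
  τ∉S (g , h) (_ , bh , ch≡true) (_ , _ , cτh≡true) = τ-leaves-colourClass c c-proper NH h bh ch≡true cτh≡true
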